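{- Let $N$ be a finite commutative nilsemigroup. Then $$\mathcal{L}(N)\leq \mathsf D(N)\leq \mathcal{L}(N)+1 .$$
   Context: A commutative nilsemigroup is a commutative semigroup (written additively) with a zero element $\infty_N$ in which every element $x$ satisfies $nx=\infty_N$ for some $n>0$. A finite commutative nilsemigroup is nilpotent, i.e. the $t$-fold sumset $N+\cdots+N$ ($t$ summands) is a single element for some $t>0$; the least such $t$ is the nilpotency index $\mathcal{L}(N)$. A sequence over $N$ is a finite unordered sequence of elements of $N$ with repetition allowed; $|A|$ is its length and $\sigma(A)$ the sum of its terms. The empty sequence is allowed as a subsequence only when $N$ has an identity element $0_N$, and then $\sigma(\text{empty})=0_N$. A sequence $A$ is reducible if $\sigma(B)=\sigma(A)$ for some proper subsequence $B$ of $A$ ($B$ a subsequence, $B\ne A$). $\mathsf D(N)$ is the smallest $\ell$ such that every sequence over $N$ of length $\ge\ell$ is reducible. -}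

module Defs where

open import Data.Nat using (ℕ; zero; suc; _+_; _≤_; _<_)
open import Data.Fin using (Fin)
open import Data.List using (List; []; _∷_; length; foldr; replicate)
open import Data.List.Relation.Binary.Sublist.Propositional using (_⊆_)
open import Data.Product using (Σ; ∃; _×_; _,_)
open import Data.Sum using (_⊎_)
open import Function.Bundles using (_⇔_)
open import Relation.Binary.PropositionalEquality using (_≡_)

-- A finite commutative nilsemigroup: the carrier is Fin n (any finite set,
-- up to isomorphism), written additively, with zero element ∞.
record FinNilSemigroup (n : ℕ) : Set where
  field
    _⊕_    : Fin n → Fin n → Fin n
    assoc  : ∀ x y z → (x ⊕ y) ⊕ z ≡ x ⊕ (y ⊕ z)
    comm   : ∀ x y → x ⊕ y ≡ y ⊕ x
    ∞N     : Fin n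
    zeroL  : ∀ x → ∞N ⊕ x ≡ ∞N
    zeroR  : ∀ x → x ⊕ ∞N ≡ ∞N
  σ⁺ : Fin n → List (Fin n) → Fin n
  σ⁺ x xs = foldr _⊕_ x xs
  field
    -- every x satisfies (k+1)·x = ∞ for some k, i.e. m·x = ∞ for some m > 0
    nil    : ∀ x → ∃ λ k → σ⁺ x (replicate k x) ≡ ∞N

module _ {n : ℕ} (N : FinNilSemigroup n) where
  open FinNilSemigroup N

  IsIdentity : Fin n → Set
  IsIdentity e = ∀ x → e ⊕ x ≡ x

  -- σ(B) = s, where the empty sequence is only allowed when N has an
  -- identity (and then σ(empty) = the identity)
  SumIs : List (Fin n) → Fin n → Set
  SumIs []       s = IsIdentity s
  SumIs (b ∷ bs) s = σ⁺ b bs ≡ s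

  -- A is reducible: some proper subsequence B (a sublist of A of smaller
  -- length) has σ(B) = σ(A).  Only meaningful for nonempty A; the empty
  -- sequence has no proper subsequence.
  Reducible : List (Fin n) → Set
  Reducible []       = Σ (List (Fin n)) λ B → B ⊆ [] × length B < 0
  Reducible (a ∷ as) = Σ (List (Fin n)) λ B →
    B ⊆ (a ∷ as) × length B < length (a ∷ as) × SumIs B (σ⁺ a as)

  AllReducibleFrom : ℕ → Set
  AllReducibleFrom ℓ = ∀ (A : List (Fin n)) → ℓ ≤ length A → Reducible A

  IsDavenport : ℕ → Set
  IsDavenport ℓ = AllReducibleFrom ℓ × (∀ m → AllReducibleFrom m → ℓ ≤ m)

  InSumset : ℕ → Fin n → Set
  InSumset t x = Σ (Fin n) λ a → Σ (List (Fin n)) λ as →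
    suc (length as) ≡ t × σ⁺ a as ≡ x

  SumsetSingleton : ℕ → Set
  SumsetSingleton t = ∃ λ z → ∀ x → InSumset t x ⇔ (x ≡ z)

  IsNilIndex : ℕ → Set
  IsNilIndex t = 0 < t × SumsetSingleton t
               × (∀ u → 0 < u → SumsetSingleton u → t ≤ u)

-- Adjoin an identity to N, so that every sequence has a sum σ⁰.  By pigeonhole every
-- sufficiently long sequence sums to ∞, and the least length L for which all sequences do is
-- the nilpotency index (found by exhaustive search over the finitely many sequences of each
-- length).  A reducible sequence sums to ∞: if σ(B) = σ(A) = y for a proper subsequence B,
-- then y + c = y for c = σ(A ∖ B), so y = y + kc = ∞ for k large.  Hence all sequences of
-- length D(N) sum to ∞, i.e. L ≤ D(N); and a sequence longer than L as well as its tail sum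
-- to ∞, so D(N) ≤ L + 1.  Which of the two values D(N) takes is decided by checking all
-- sequences of length L.
module Submission where

open import Defs
open import Data.Nat using (ℕ; zero; suc; _+_; _≤_; _<_; _<?_; z≤n; s≤s)
open import Data.Nat.Properties
open import Data.Nat.Induction using (<-rec)
open import Data.Nat.ListAction using (sum)
open import Data.Fin using (Fin)
open import Data.Fin.Properties using (all?) renaming (_≟_ to _≟ᶠ_)
open import Data.Maybe using (Maybe; just; nothing)
open import Data.Maybe.Properties using (just-injective; ≡-dec)
open import Data.List using (List; []; _∷_; length; replicate; filter; map; allFin)
open import Data.List.Relation.Binary.Sublist.Propositional using (_⊆_; []; _∷ʳ_; _∷_; ⊆-refl)
open import Data.List.Relation.Unary.All as All using (All; []; _∷_)
open import Data.List.Relation.Unary.All.Properties using (all-filter; filter⁺)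
open import Data.List.Relation.Unary.Any using (here; there)
open import Data.List.Membership.Propositional using (_∈_)
open import Data.List.Membership.Propositional.Properties using (∈-allFin)
open import Data.List.Properties using (length-replicate)
open import Data.Product using (Σ; ∃; _×_; _,_; proj₁; proj₂)
open import Data.Sum using (inj₁; inj₂)
open import Function using (_∘_; mk⇔; Equivalence)
open import Relation.Nullary using (Dec; yes; no; ¬_; contradiction)
open import Relation.Nullary.Decidable using (map′; _×-dec_; _⊎-dec_)
open import Relation.Unary using (Decidable)
open import Relation.Unary.Properties using (∁?)
open import Relation.Binary.PropositionalEquality

Least : (ℕ → Set) → ℕ → Set
Least P ℓ = P ℓ × (∀ u → P u → ℓ ≤ u)

least : {P : ℕ → Set} → Decidable P → ∀ {t} → P t → ∃ (Least P)
least {P} P? {t} = <-rec (λ t → P t → ∃ (Least P)) search t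
  where
    search : ∀ t → (∀ {u} → u < t → P u → ∃ (Least P)) → P t → ∃ (Least P)
    search t rec Pt with anyUpTo? P? t
    ... | yes (u , u<t , Pu) = rec u<t Pu
    ... | no ¬smaller = t , Pt , λ u Pu → ≮⇒≥ λ u<t → ¬smaller (u , u<t , Pu)

any-sublist? : {A : Set} {Q : List A → Set} → Decidable Q →
               ∀ xs → Dec (∃ λ ys → ys ⊆ xs × Q ys)
any-sublist? Q? [] = map′ (λ q → [] , [] , q) (λ { (_ , [] , q) → q }) (Q? [])
any-sublist? Q? (x ∷ xs) =
  map′ (λ { (inj₁ (ys , p , q)) → ys , x ∷ʳ p , q
          ; (inj₂ (ys , p , q)) → x ∷ ys , refl ∷ p , q })
       (λ { (ys , _ ∷ʳ p , q) → inj₁ (ys , p , q)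
          ; (_ ∷ ys , refl ∷ p , q) → inj₂ (ys , p , q) })
       (any-sublist? Q? xs ⊎-dec any-sublist? (Q? ∘ (x ∷_)) xs)

all-ofLength? : ∀ {n} {P : List (Fin n) → Set} → Decidable P →
                ∀ k → Dec (∀ xs → length xs ≡ k → P xs)
all-ofLength? P? zero = map′ (λ P[] → λ { [] _ → P[] }) (λ ∀P → ∀P [] refl) (P? [])
all-ofLength? P? (suc k) =
  map′ (λ ∀P → λ { (x ∷ xs) eq → ∀P x xs (suc-injective eq) })
       (λ ∀P x xs eq → ∀P (x ∷ xs) (cong suc eq))
       (all? λ x → all-ofLength? (P? ∘ (x ∷_)) k)

all≡⇒replicate : {A : Set} {x : A} {xs : List A} → All (x ≡_) xs → xs ≡ replicate (length xs) x
all≡⇒replicate []           = refl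
all≡⇒replicate (refl ∷ eqs) = cong (_ ∷_) (all≡⇒replicate eqs)

module FinNilSemigroupProperties {n : ℕ} (N : FinNilSemigroup n) where
  open FinNilSemigroup N

  -- N with an identity adjoined, represented by nothing.
  infixr 6 _+⁰_

  _+⁰_ : Maybe (Fin n) → Maybe (Fin n) → Maybe (Fin n)
  nothing +⁰ y      = y
  just x  +⁰ nothing = just x
  just x  +⁰ just y  = just (x ⊕ y)

  +⁰-assoc : ∀ x y z → (x +⁰ y) +⁰ z ≡ x +⁰ (y +⁰ z)
  +⁰-assoc nothing  y        z        = refl
  +⁰-assoc (just x) nothing  z        = refl
  +⁰-assoc (just x) (just y) nothing  = refl
  +⁰-assoc (just x) (just y) (just z) = cong just (assoc x y z)

  +⁰-comm : ∀ x y → x +⁰ y ≡ y +⁰ x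
  +⁰-comm nothing  nothing  = refl
  +⁰-comm nothing  (just y) = refl
  +⁰-comm (just x) nothing  = refl
  +⁰-comm (just x) (just y) = cong just (comm x y)

  +⁰-leftSwap : ∀ x y z → x +⁰ (y +⁰ z) ≡ y +⁰ (x +⁰ z)
  +⁰-leftSwap x y z = begin
    x +⁰ (y +⁰ z)  ≡⟨ +⁰-assoc x y z ⟨
    (x +⁰ y) +⁰ z  ≡⟨ cong (_+⁰ z) (+⁰-comm x y) ⟩
    (y +⁰ x) +⁰ z  ≡⟨ +⁰-assoc y x z ⟩
    y +⁰ (x +⁰ z)  ∎
    where open ≡-Reasoning

  ∞⁰ : Maybe (Fin n)
  ∞⁰ = just ∞N

  +⁰-zeroˡ : ∀ x → ∞⁰ +⁰ x ≡ ∞⁰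
  +⁰-zeroˡ nothing  = refl
  +⁰-zeroˡ (just x) = cong just (zeroL x)

  +⁰-zeroʳ : ∀ x → x +⁰ ∞⁰ ≡ ∞⁰
  +⁰-zeroʳ x = trans (+⁰-comm x ∞⁰) (+⁰-zeroˡ x)

  σ⁰ : List (Fin n) → Maybe (Fin n)
  σ⁰ []       = nothing
  σ⁰ (x ∷ xs) = just x +⁰ σ⁰ xs

  σ⁰-∷ : ∀ x xs → σ⁰ (x ∷ xs) ≡ just (σ⁺ x xs)
  σ⁰-∷ x []       = refl
  σ⁰-∷ x (y ∷ ys) = begin
    just x +⁰ just y +⁰ σ⁰ ys  ≡⟨ +⁰-leftSwap (just x) (just y) (σ⁰ ys) ⟩
    just y +⁰ σ⁰ (x ∷ ys)      ≡⟨ cong (just y +⁰_) (σ⁰-∷ x ys) ⟩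
    just (y ⊕ σ⁺ x ys)         ∎
    where open ≡-Reasoning

  σ⁰-⊆-split : ∀ {ys xs} → ys ⊆ xs →
               ∃ λ zs → σ⁰ xs ≡ σ⁰ ys +⁰ σ⁰ zs × length xs ≡ length ys + length zs
  σ⁰-⊆-split [] = [] , refl , refl
  σ⁰-⊆-split {ys} (x ∷ʳ p) with σ⁰-⊆-split p
  ... | zs , σ-eq , len-eq =
    x ∷ zs , trans (cong (just x +⁰_) σ-eq) (+⁰-leftSwap (just x) (σ⁰ ys) (σ⁰ zs))
           , trans (cong suc len-eq) (sym (+-suc (length ys) (length zs)))
  σ⁰-⊆-split {x ∷ ys} (refl ∷ p) with σ⁰-⊆-split p
  ... | zs , σ-eq , len-eq =
    zs , trans (cong (just x +⁰_) σ-eq) (sym (+⁰-assoc (just x) (σ⁰ ys) (σ⁰ zs))) , cong suc len-eq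

  module _ {P : Fin n → Set} (P? : Decidable P) where

    σ⁰-filter : ∀ xs → σ⁰ xs ≡ σ⁰ (filter P? xs) +⁰ σ⁰ (filter (∁? P?) xs)
    σ⁰-filter []       = refl
    σ⁰-filter (x ∷ xs) with P? x
    ... | yes _ = trans (cong (just x +⁰_) (σ⁰-filter xs))
                        (sym (+⁰-assoc (just x) (σ⁰ (filter P? xs)) (σ⁰ (filter (∁? P?) xs))))
    ... | no _  = trans (cong (just x +⁰_) (σ⁰-filter xs))
                        (+⁰-leftSwap (just x) (σ⁰ (filter P? xs)) (σ⁰ (filter (∁? P?) xs)))

    length-filter-∁ : ∀ xs → length xs ≡ length (filter P? xs) + length (filter (∁? P?) xs)
    length-filter-∁ []       = refl
    length-filter-∁ (x ∷ xs) with P? x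
    ... | yes _ = cong suc (length-filter-∁ xs)
    ... | no _  = trans (cong suc (length-filter-∁ xs))
                        (sym (+-suc (length (filter P? xs)) (length (filter (∁? P?) xs))))

    length-filter-∁-< : ∀ xs {k b} → suc k + b < length xs → ¬ k < length (filter P? xs) →
                        b < length (filter (∁? P?) xs)
    length-filter-∁-< xs {k} {b} long few = +-cancelˡ-< (suc k) b (length rejected) (begin-strict
      suc k + b                         <⟨ long ⟩
      length xs                         ≡⟨ length-filter-∁ xs ⟩
      length accepted + length rejected ≤⟨ +-monoˡ-≤ (length rejected) (≮⇒≥ few) ⟩
      k + length rejected               <⟨ ≤-refl ⟩
      suc k + length rejected           ∎)
      where
        open ≤-Reasoning
        accepted = filter P? xs
        rejected = filter (∁? P?) xs

  σ⁺-∞ : ∀ xs → σ⁺ ∞N xs ≡ ∞N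
  σ⁺-∞ []       = refl
  σ⁺-∞ (x ∷ xs) = trans (cong (x ⊕_) (σ⁺-∞ xs)) (zeroR x)

  -- (1 + nilExp x) · x = ∞
  nilExp : Fin n → ℕ
  nilExp x = proj₁ (nil x)

  σ⁰-replicate≡∞ : ∀ x m → nilExp x < m → σ⁰ (replicate m x) ≡ ∞⁰
  σ⁰-replicate≡∞ x (suc m) k<1+m with m≤n⇒m<n∨m≡n (≤-pred k<1+m)
  ... | inj₁ k<m  = trans (cong (just x +⁰_) (σ⁰-replicate≡∞ x m k<m)) (+⁰-zeroʳ (just x))
  ... | inj₂ refl = trans (σ⁰-∷ x (replicate (nilExp x) x)) (cong just (proj₂ (nil x)))

  σ⁰-constant≡∞ : ∀ {x xs} → All (x ≡_) xs → nilExp x < length xs → σ⁰ xs ≡ ∞⁰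
  σ⁰-constant≡∞ {x} {xs} eqs k<len =
    trans (cong σ⁰ (all≡⇒replicate eqs)) (σ⁰-replicate≡∞ x (length xs) k<len)

  nilBound : List (Fin n) → ℕ
  nilBound S = sum (map (suc ∘ nilExp) S)

  -- Pigeonhole: some s ∈ S occurs more than nilExp s times in xs.
  σ⁰-long≡∞ : ∀ S xs → All (_∈ S) xs → nilBound S < length xs → σ⁰ xs ≡ ∞⁰
  σ⁰-long≡∞ []      []       []       ()
  σ⁰-long≡∞ []      (x ∷ xs) (() ∷ _) _
  σ⁰-long≡∞ (s ∷ S) xs       xs∈s∷S   long =
    trans (σ⁰-filter (s ≟ᶠ_) xs) (summand≡∞ (nilExp s <? length copies))
    where
      copies = filter (s ≟ᶠ_) xs
      others = filter (∁? (s ≟ᶠ_)) xs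
      others∈S : All (_∈ S) others
      others∈S = All.zipWith (λ { (here s≡x , s≢x) → contradiction (sym s≡x) s≢x
                                ; (there x∈S , _) → x∈S })
                             (filter⁺ (∁? (s ≟ᶠ_)) xs∈s∷S , all-filter (∁? (s ≟ᶠ_)) xs)
      summand≡∞ : Dec (nilExp s < length copies) → σ⁰ copies +⁰ σ⁰ others ≡ ∞⁰
      summand≡∞ (yes many) =
        trans (cong (_+⁰ σ⁰ others) (σ⁰-constant≡∞ (all-filter (s ≟ᶠ_) xs) many))
              (+⁰-zeroˡ (σ⁰ others))
      summand≡∞ (no few) =
        trans (cong (σ⁰ copies +⁰_)
                    (σ⁰-long≡∞ S others others∈S (length-filter-∁-< (s ≟ᶠ_) xs long few)))
              (+⁰-zeroʳ (σ⁰ copies))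

  SumsAre∞ : ℕ → Set
  SumsAre∞ u = ∀ xs → length xs ≡ u → σ⁰ xs ≡ ∞⁰

  sumsAre∞? : Decidable SumsAre∞
  sumsAre∞? = all-ofLength? (λ xs → ≡-dec _≟ᶠ_ (σ⁰ xs) ∞⁰)

  ¬sumsAre∞-zero : ¬ SumsAre∞ 0
  ¬sumsAre∞-zero sums with sums [] refl
  ... | ()

  sumsAre∞-suc : ∀ {u} → SumsAre∞ u → SumsAre∞ (suc u)
  sumsAre∞-suc sums (x ∷ xs) eq =
    trans (cong (just x +⁰_) (sums xs (suc-injective eq))) (+⁰-zeroʳ (just x))

  sumsAre∞-mono : ∀ {u v} → u ≤ v → SumsAre∞ u → SumsAre∞ v
  sumsAre∞-mono u≤v sums with m≤n⇒m<n∨m≡n u≤v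
  ... | inj₂ refl = sums
  sumsAre∞-mono {v = suc v} _ sums | inj₁ u<1+v = sumsAre∞-suc (sumsAre∞-mono (≤-pred u<1+v) sums)

  sumsAre∞-nilBound : SumsAre∞ (suc (nilBound (allFin n)))
  sumsAre∞-nilBound xs eq =
    σ⁰-long≡∞ (allFin n) xs (All.tabulate λ {x} _ → ∈-allFin x) (≤-reflexive (sym eq))

  ∞∈sumset : ∀ k → InSumset N (suc k) ∞N
  ∞∈sumset k = ∞N , replicate k ∞N , cong suc (length-replicate k) , σ⁺-∞ (replicate k ∞N)

  sumsAre∞⇒sumsetSingleton : ∀ {k} → SumsAre∞ (suc k) → SumsetSingleton N (suc k)
  sumsAre∞⇒sumsetSingleton {k} sums = ∞N , λ x → mk⇔
    (λ { (a , as , eq , refl) → just-injective (trans (sym (σ⁰-∷ a as)) (sums (a ∷ as) eq)) })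
    (λ { refl → ∞∈sumset k })

  sumsetSingleton⇒sumsAre∞ : ∀ {k} → SumsetSingleton N (suc k) → SumsAre∞ (suc k)
  sumsetSingleton⇒sumsAre∞ {k} (z , sumset≡z) (a ∷ as) eq = begin
    σ⁰ (a ∷ as)   ≡⟨ σ⁰-∷ a as ⟩
    just (σ⁺ a as) ≡⟨ cong just (Equivalence.to (sumset≡z _) (a , as , eq , refl)) ⟩
    just z         ≡⟨ cong just (Equivalence.to (sumset≡z ∞N) (∞∈sumset k)) ⟨
    ∞⁰             ∎
    where open ≡-Reasoning

  nilIndex : ∃ (Least SumsAre∞)
  nilIndex = least sumsAre∞? sumsAre∞-nilBound

  L : ℕ
  L = proj₁ nilIndex

  sumsAre∞-L : SumsAre∞ L
  sumsAre∞-L = proj₁ (proj₂ nilIndex)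

  L-minimal : ∀ u → SumsAre∞ u → L ≤ u
  L-minimal = proj₂ (proj₂ nilIndex)

  isNilIndex : IsNilIndex N L
  isNilIndex with L | sumsAre∞-L | L-minimal
  ... | zero  | sums | _       = contradiction sums ¬sumsAre∞-zero
  ... | suc k | sums | minimal =
    s≤s z≤n , sumsAre∞⇒sumsetSingleton sums ,
    λ { (suc u) _ singleton → minimal (suc u) (sumsetSingleton⇒sumsAre∞ singleton) }

  absorbs⇒∞ : ∀ y c → y ⊕ c ≡ y → y ≡ ∞N
  absorbs⇒∞ y c y+c≡y = just-injective (begin
    just y                                    ≡⟨ absorbs-replicate (suc (nilExp c)) ⟨
    just y +⁰ σ⁰ (replicate (suc (nilExp c)) c) ≡⟨ cong (just y +⁰_) (σ⁰-replicate≡∞ c _ ≤-refl) ⟩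
    just y +⁰ ∞⁰                              ≡⟨ +⁰-zeroʳ (just y) ⟩
    ∞⁰                                        ∎)
    where
      open ≡-Reasoning
      absorbs-replicate : ∀ m → just y +⁰ σ⁰ (replicate m c) ≡ just y
      absorbs-replicate zero    = refl
      absorbs-replicate (suc m) = begin
        just y +⁰ just c +⁰ σ⁰ (replicate m c)   ≡⟨ +⁰-assoc (just y) (just c) (σ⁰ (replicate m c)) ⟨
        (just y +⁰ just c) +⁰ σ⁰ (replicate m c) ≡⟨ cong (λ z → just z +⁰ σ⁰ (replicate m c)) y+c≡y ⟩
        just y +⁰ σ⁰ (replicate m c)             ≡⟨ absorbs-replicate m ⟩
        just y                                   ∎

  reducible⇒σ⁰≡∞ : ∀ xs → Reducible N xs → σ⁰ xs ≡ ∞⁰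
  reducible⇒σ⁰≡∞ [] (_ , _ , ())
  reducible⇒σ⁰≡∞ (a ∷ as) ([] , _ , _ , y-identity) =
    trans (σ⁰-∷ a as) (cong just (absorbs⇒∞ (σ⁺ a as) (σ⁺ a as) (y-identity (σ⁺ a as))))
  reducible⇒σ⁰≡∞ (a ∷ as) (b ∷ bs , B⊆xs , shorter , σB≡y) with σ⁰-⊆-split B⊆xs
  ... | [] , _ , len = contradiction (trans len (+-identityʳ (length (b ∷ bs)))) (>⇒≢ shorter)
  ... | c ∷ cs , split , _ = trans (σ⁰-∷ a as) (cong just (absorbs⇒∞ y (σ⁺ c cs) y+c≡y))
    where
      y = σ⁺ a as
      y+c≡y : y ⊕ σ⁺ c cs ≡ y
      y+c≡y = just-injective (begin
        just (y ⊕ σ⁺ c cs)         ≡⟨ cong (λ z → just (z ⊕ σ⁺ c cs)) σB≡y ⟨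
        just (σ⁺ b bs ⊕ σ⁺ c cs)   ≡⟨ cong₂ _+⁰_ (σ⁰-∷ b bs) (σ⁰-∷ c cs) ⟨
        σ⁰ (b ∷ bs) +⁰ σ⁰ (c ∷ cs) ≡⟨ split ⟨
        σ⁰ (a ∷ as)                ≡⟨ σ⁰-∷ a as ⟩
        just y                     ∎)
        where open ≡-Reasoning

  sumIs? : ∀ xs s → Dec (SumIs N xs s)
  sumIs? []       s = all? λ x → s ⊕ x ≟ᶠ x
  sumIs? (x ∷ xs) s = σ⁺ x xs ≟ᶠ s

  reducible? : Decidable (Reducible N)
  reducible? []       = no λ { (_ , _ , ()) }
  reducible? (a ∷ as) =
    any-sublist? (λ B → (length B <? length (a ∷ as)) ×-dec sumIs? B (σ⁺ a as)) (a ∷ as)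

  reducibleFrom⇒sumsAre∞ : ∀ {m} → AllReducibleFrom N m → SumsAre∞ m
  reducibleFrom⇒sumsAre∞ reducible xs refl = reducible⇒σ⁰≡∞ xs (reducible xs ≤-refl)

  reducibleFrom⇒L≤ : ∀ {m} → AllReducibleFrom N m → L ≤ m
  reducibleFrom⇒L≤ {m} reducible = L-minimal m (reducibleFrom⇒sumsAre∞ reducible)

  reducibleFrom-pred : ∀ {ℓ} → (∀ xs → length xs ≡ ℓ → Reducible N xs) →
                       AllReducibleFrom N (suc ℓ) → AllReducibleFrom N ℓ
  reducibleFrom-pred exact longer xs ℓ≤len with m≤n⇒m<n∨m≡n ℓ≤len
  ... | inj₁ ℓ<len = longer xs ℓ<len
  ... | inj₂ ℓ≡len = exact xs (sym ℓ≡len)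

  reducibleFrom-suc-L : AllReducibleFrom N (suc L)
  reducibleFrom-suc-L (a ∷ []) (s≤s L≤0) =
    contradiction (sumsAre∞-mono L≤0 sumsAre∞-L) ¬sumsAre∞-zero
  reducibleFrom-suc-L (a ∷ b ∷ bs) (s≤s L≤len) =
    b ∷ bs , a ∷ʳ ⊆-refl , ≤-refl , just-injective (begin
      just (σ⁺ b bs)        ≡⟨ σ⁰-∷ b bs ⟨
      σ⁰ (b ∷ bs)           ≡⟨ sums (b ∷ bs) refl ⟩
      ∞⁰                    ≡⟨ sumsAre∞-suc sums (a ∷ b ∷ bs) refl ⟨
      σ⁰ (a ∷ b ∷ bs)       ≡⟨ σ⁰-∷ a (b ∷ bs) ⟩
      just (σ⁺ a (b ∷ bs))  ∎)
    where
      open ≡-Reasoning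
      sums : SumsAre∞ (length (b ∷ bs))
      sums = sumsAre∞-mono L≤len sumsAre∞-L

  davenport-bounds : Σ ℕ λ D → IsDavenport N D × L ≤ D × D ≤ L + 1
  davenport-bounds with all-ofLength? reducible? L
  ... | yes reducible-L =
    L , (reducibleFrom-pred reducible-L reducibleFrom-suc-L , λ _ → reducibleFrom⇒L≤) ,
    ≤-refl , m≤m+n L 1
  ... | no irreducible-L =
    suc L , (reducibleFrom-suc-L , L<lowerBound) , n≤1+n L , ≤-reflexive (+-comm 1 L)
    where
      L<lowerBound : ∀ m → AllReducibleFrom N m → suc L ≤ m
      L<lowerBound m reducible = ≰⇒> λ m≤L →
        irreducible-L λ xs len≡L → reducible xs (≤-trans m≤L (≤-reflexive (sym len≡L)))

mainTheorem6 : ∀ {n : ℕ} (N : FinNilSemigroup n) →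
    Σ ℕ λ L → Σ ℕ λ D →
      IsNilIndex N L × IsDavenport N D × L ≤ D × D ≤ L + 1
mainTheorem6 N = L , proj₁ davenport-bounds , isNilIndex , proj₂ davenport-bounds
  where open FinNilSemigroupProperties N
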